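{- Let $K$ be a field with a non-trivial valuation $v$ and let $A(x)=\sum_{i=0}^n a_ix^i\in K[x]$ be a polynomial of degree $n$. Assume that the characteristic of the residue field of $v$ does not divide $n$. If $A(x)$ is an Eisenstein–Dumas polynomial at $v$, then $$n\,v\Big(\frac{a_{n-1}}{na_n}\Big)>v(a_0)-v(a_n).$$
   Context: $v:K\to\Gamma\cup\{\infty\}$ is a non-trivial Krull valuation with values in a linearly ordered abelian group $\Gamma$ ($v(0)=\infty$, greater than every element of $\Gamma$). The residue field of $v$ is $R_v/M_v$, $R_v=\{a:v(a)\ge0\}$, $M_v=\{a:v(a)>0\}$. A polynomial $\sum_{i=0}^n b_ix^i$ is Eisenstein–Dumas at $v$ if (D0) $b_0b_n\neq0$; (D1) $v(b_0)-v(b_n)\notin k\Gamma=\{kg:g\in\Gamma\}$ for every integer $k>1$ dividing $n$; (D2) $nv(b_i)\ge (n-i)v(b_0)+iv(b_n)$ for $0\le i\le n$. -}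

module Defs where

open import Level using (Level; _⊔_) renaming (suc to lsuc)
open import Algebra.Bundles using (CommutativeRing)
open import Algebra.Core using (Op₁; Op₂)
open import Algebra.Structures using (IsAbelianGroup)
open import Relation.Binary.Core using (Rel)
open import Relation.Binary.Structures using (IsTotalOrder)
open import Relation.Nullary using (¬_)
open import Data.Nat as ℕ using (ℕ; zero; suc; _∸_)
open import Data.Nat.Divisibility using (_∣_)
open import Data.Product using (Σ; ∃; _×_; _,_)
open import Data.Sum using (_⊎_)
open import Data.Unit.Polymorphic using (⊤)
open import Data.Empty.Polymorphic using (⊥)
open import Relation.Binary.PropositionalEquality using (_≡_)

-- Fields: a commutative ring with 1 ≠ 0 and a (total) inverse function
-- that is a multiplicative inverse on nonzero elements
-- (the value of 0 ⁻¹ is unspecified and never used).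

record Field c ℓ : Set (lsuc (c ⊔ ℓ)) where
  field
    commutativeRing : CommutativeRing c ℓ
  open CommutativeRing commutativeRing public
  field
    _⁻¹       : Op₁ Carrier
    ⁻¹-cong   : ∀ {x y} → x ≈ y → (x ⁻¹) ≈ (y ⁻¹)
    inverseʳ  : ∀ x → ¬ (x ≈ 0#) → (x * (x ⁻¹)) ≈ 1#
    1≉0       : ¬ (1# ≈ 0#)

  ℕ→K : ℕ → Carrier
  ℕ→K zero    = 0#
  ℕ→K (suc m) = 1# + ℕ→K m

record LinOrdAbGroup c ℓ₁ ℓ₂ : Set (lsuc (c ⊔ ℓ₁ ⊔ ℓ₂)) where
  infixl 6 _+_
  field
    Carrier        : Set c
    _≈_            : Rel Carrier ℓ₁
    _≤_            : Rel Carrier ℓ₂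
    _+_            : Op₂ Carrier
    0#             : Carrier
    -_             : Op₁ Carrier
    isAbelianGroup : IsAbelianGroup _≈_ _+_ 0# -_
    isTotalOrder   : IsTotalOrder _≈_ _≤_
    +-mono-≤       : ∀ {x y} z → x ≤ y → (x + z) ≤ (y + z)

  _-_ : Op₂ Carrier
  x - y = x + (- y)

  _·_ : ℕ → Carrier → Carrier
  zero  · g = 0#
  suc k · g = g + (k · g)

data WithTop {a} (A : Set a) : Set a where
  fin : A → WithTop A
  ∞   : WithTop A

module Extended {c ℓ₁ ℓ₂} (Γ : LinOrdAbGroup c ℓ₁ ℓ₂) where
  open LinOrdAbGroup Γ

  Γ∞ : Set c
  Γ∞ = WithTop Carrier

  _≈∞_ : Γ∞ → Γ∞ → Set ℓ₁
  fin x ≈∞ fin y = x ≈ y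
  ∞     ≈∞ ∞     = ⊤
  _     ≈∞ _     = ⊥

  _≤∞_ : Γ∞ → Γ∞ → Set ℓ₂
  fin x ≤∞ fin y = x ≤ y
  _     ≤∞ ∞     = ⊤
  ∞     ≤∞ fin _ = ⊥

  _<∞_ : Γ∞ → Γ∞ → Set ℓ₂
  x <∞ y = (x ≤∞ y) × ¬ (y ≤∞ x)

  _+∞_ : Γ∞ → Γ∞ → Γ∞
  fin x +∞ fin y = fin (x + y)
  _     +∞ _     = ∞

  _·∞_ : ℕ → Γ∞ → Γ∞
  zero  ·∞ x = fin 0#
  suc k ·∞ x = x +∞ (k ·∞ x)

record Valuation {c ℓ c' ℓ₁ ℓ₂} (K : Field c ℓ) (Γ : LinOrdAbGroup c' ℓ₁ ℓ₂)
       : Set (c ⊔ ℓ ⊔ c' ⊔ ℓ₁ ⊔ ℓ₂) where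
  open Field K
  open Extended Γ
  field
    v          : Carrier → Γ∞
    v-cong     : ∀ {x y} → x ≈ y → v x ≈∞ v y
    v-∞⇒0      : ∀ x → v x ≈∞ ∞ → x ≈ 0#
    v-0        : v 0# ≈∞ ∞
    v-mul      : ∀ x y → v (x * y) ≈∞ (v x +∞ v y)
    -- v(x + y) ≥ min(v x, v y): every lower bound of v x and v y is ≤ v(x+y)
    v-add      : ∀ x y z → z ≤∞ v x → z ≤∞ v y → z ≤∞ v (x + y)
    nontrivial : ∃ λ x → ¬ (x ≈ 0#) × ¬ (v x ≈∞ fin (LinOrdAbGroup.0# Γ))

module _ {c ℓ c' ℓ₁ ℓ₂} {K : Field c ℓ} {Γ : LinOrdAbGroup c' ℓ₁ ℓ₂}
         (V : Valuation K Γ) where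
  open Field K
  open Extended Γ
  open Valuation V
  private
    module G = LinOrdAbGroup Γ

  InM : Carrier → Set ℓ₂
  InM x = fin G.0# <∞ v x

  -- p is the characteristic of the residue field R_v / M_v.
  -- The class of m·1 (m ∈ ℕ, m·1 ∈ R_v) is zero in R_v/M_v iff m·1 ∈ M_v.
  ResidueChar : ℕ → Set ℓ₂
  ResidueChar p =
      (p ≡ 0 × (∀ m → 0 ℕ.< m → ¬ InM (ℕ→K m)))
    ⊎ (0 ℕ.< p × InM (ℕ→K p) × (∀ m → 0 ℕ.< m → m ℕ.< p → ¬ InM (ℕ→K m)))

  -- Σ_{i=0}^n b_i x^i (coefficients b : ℕ → K, only b 0 … b n used)
  -- is Eisenstein–Dumas at v.
  record EisensteinDumas (n : ℕ) (b : ℕ → Carrier) : Set (ℓ ⊔ c' ⊔ ℓ₁ ⊔ ℓ₂) where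
    field
      D0 : ¬ (b 0 ≈ 0#) × ¬ (b n ≈ 0#)
      D1 : ∀ k → 1 ℕ.< k → k ∣ n → ∀ g₀ gₙ → v (b 0) ≈∞ fin g₀ → v (b n) ≈∞ fin gₙ →
           ¬ (Σ G.Carrier λ g → (g₀ G.- gₙ) G.≈ (k G.· g))
      D2 : ∀ i → i ℕ.≤ n →
           (((n ∸ i) ·∞ v (b 0)) +∞ (i ·∞ v (b n))) ≤∞ (n ·∞ v (b i))

{-# OPTIONS --safe #-}
module Submission where

-- As the residue characteristic does not divide n, n·1 is a unit of R_v, so v(n aₙ) = v(aₙ).
-- Condition D2 at i = n - 1 reads n·v(aₙ₋₁) ≥ v(a₀) + (n - 1)·v(aₙ), that is
-- n·v(aₙ₋₁/(n aₙ)) ≥ v(a₀) - v(aₙ); equality would make v(a₀) - v(aₙ) an n-fold multiple,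
-- which D1 with k = n forbids.
-- That n·1 ∉ M_v holds because the residue characteristic p, the least positive integer with
-- p·1 ∈ M_v, divides every m with m·1 ∈ M_v (m mod p is again such an integer).
-- Membership in M_v is not decidable, so this least element, and with it v(n·1) = 0, is only
-- available under double negation; that suffices, since what remains to show is a negation.

open import Defs
open import Level using (Level)
open import Data.Nat using (ℕ; _∸_)
open import Data.Nat.Divisibility using (_∣_)
open import Relation.Nullary using (¬_)

open import Algebra.Bundles using (AbelianGroup)
import Algebra.Properties.AbelianGroup as AbelianGroupProperties
import Algebra.Properties.Group as GroupProperties
import Algebra.Properties.CommutativeMonoid.Mult as CommutativeMonoidMult
import Algebra.Properties.Ring as RingProperties
import Algebra.Properties.Semiring.Mult as SemiringMult
open import Data.Nat as ℕ using (zero; suc; _<_; s≤s; z≤n)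
open import Data.Nat.Divisibility using (∣-refl; m%n≡0⇒n∣m)
open import Data.Nat.DivMod using (_%_; _/_; m≡m%n+[m/n]*n; m%n<n)
open import Data.Nat.Induction using (<-rec)
import Data.Nat.Properties as ℕ
open import Data.Empty.Polymorphic using (⊥-elim)
open import Data.Product using (∃; _×_; _,_)
open import Data.Sum using (_⊎_; inj₁; inj₂)
open import Data.Unit.Polymorphic using (tt)
open import Relation.Binary.PropositionalEquality using (_≡_; refl; cong; cong₂; subst)
open import Relation.Binary.Bundles using (Setoid)
open import Relation.Binary.Structures using (IsTotalOrder)
import Relation.Binary.Reasoning.Setoid as SetoidReasoning
open import Relation.Nullary using (yes; no; contradiction)

¬¬-minimal : ∀ {p} (P : ℕ → Set p) n → P n → ¬ ¬ (∃ λ m → P m × (∀ k → k < m → ¬ P k))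
¬¬-minimal P = <-rec _ λ n smaller Pn no-minimal →
  no-minimal (n , Pn , λ k k<n Pk → smaller k<n Pk no-minimal)

module OrderedGroupProperties {c ℓ₁ ℓ₂} (Γ : LinOrdAbGroup c ℓ₁ ℓ₂) where
  private
    module G = LinOrdAbGroup Γ
  open G hiding (_≤_)
    renaming (_≈_ to infix 4 _≈_; _-_ to infixl 6 _-_; _·_ to infixr 8 _·_)
  open G using () renaming (_≤_ to infix 4 _≤_)
  open Extended Γ

  abelianGroup : AbelianGroup c ℓ₁
  abelianGroup = record { isAbelianGroup = isAbelianGroup }

  private
    module A = AbelianGroup abelianGroup
    module O = IsTotalOrder isTotalOrder
    module Mult = CommutativeMonoidMult A.commutativeMonoid
  open AbelianGroupProperties abelianGroup public using (identityʳ-unique; inverseʳ-unique)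
  open SetoidReasoning A.setoid

  ·≡× : ∀ k g → k · g ≡ k Mult.× g
  ·≡× zero    g = refl
  ·≡× (suc k) g = cong (g +_) (·≡× k g)

  ≤-respˡ-≈ : ∀ {x x' y} → x ≈ x' → x ≤ y → x' ≤ y
  ≤-respˡ-≈ x≈x' x≤y = O.trans (O.reflexive (A.sym x≈x')) x≤y

  ≤-respʳ-≈ : ∀ {x y y'} → y ≈ y' → x ≤ y → x ≤ y'
  ≤-respʳ-≈ y≈y' x≤y = O.trans x≤y (O.reflexive y≈y')

  x+y-y≈x : ∀ x y → (x + y) - y ≈ x
  x+y-y≈x x y = begin
    (x + y) - y    ≈⟨ A.assoc x y (- y) ⟩
    x + (y - y)    ≈⟨ A.∙-congˡ (A.inverseʳ y) ⟩
    x + 0#         ≈⟨ A.identityʳ x ⟩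
    x              ∎

  x-y+y≈x : ∀ x y → (x - y) + y ≈ x
  x-y+y≈x x y = begin
    (x - y) + y    ≈⟨ A.assoc x (- y) y ⟩
    x + (- y + y)  ≈⟨ A.∙-congˡ (A.inverseˡ y) ⟩
    x + 0#         ≈⟨ A.identityʳ x ⟩
    x              ∎

  +-cancelʳ-≤ : ∀ {x y} z → x + z ≤ y + z → x ≤ y
  +-cancelʳ-≤ {x} {y} z x+z≤y+z =
    ≤-respˡ-≈ (x+y-y≈x x z) (≤-respʳ-≈ (x+y-y≈x y z) (+-mono-≤ (- z) x+z≤y+z))

  ·-cong : ∀ k {x y} → x ≈ y → k · x ≈ k · y
  ·-cong zero    _   = A.refl
  ·-cong (suc k) x≈y = A.∙-cong x≈y (·-cong k x≈y)

  ·-distrib-+ : ∀ k x y → k · (x + y) ≈ k · x + k · y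
  ·-distrib-+ k x y = begin
    k · (x + y)             ≡⟨ ·≡× k (x + y) ⟩
    k Mult.× (x + y)        ≈⟨ Mult.×-distrib-+ x y k ⟩
    k Mult.× x + k Mult.× y ≡⟨ cong₂ _+_ (·≡× k x) (·≡× k y) ⟨
    k · x + k · y           ∎

  difference≈multiple : ∀ k g₀ g α → g₀ + k · g ≤ suc k · α → suc k · (α - g) ≤ g₀ - g →
                        g₀ - g ≈ suc k · (α - g)
  difference≈multiple k g₀ g α g₀+kg≤[k+1]α [k+1][α-g]≤g₀-g =
    O.antisym (+-cancelʳ-≤ (suc k · g) (≤-respˡ-≈ (A.sym lhs) (≤-respʳ-≈ (A.sym rhs) g₀+kg≤[k+1]α)))
              [k+1][α-g]≤g₀-g
    where
    lhs : (g₀ - g) + suc k · g ≈ g₀ + k · g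
    lhs = begin
      (g₀ - g) + (g + k · g)  ≈⟨ A.assoc (g₀ - g) g (k · g) ⟨
      ((g₀ - g) + g) + k · g  ≈⟨ A.∙-congʳ (x-y+y≈x g₀ g) ⟩
      g₀ + k · g              ∎
    rhs : suc k · (α - g) + suc k · g ≈ suc k · α
    rhs = begin
      suc k · (α - g) + suc k · g  ≈⟨ ·-distrib-+ (suc k) (α - g) g ⟨
      suc k · ((α - g) + g)        ≈⟨ ·-cong (suc k) (x-y+y≈x α g) ⟩
      suc k · α                    ∎

  0≈x+x⇒0≤x : ∀ {x} → 0# ≈ x + x → 0# ≤ x
  0≈x+x⇒0≤x {x} 0≈x+x with O.total 0# x
  ... | inj₁ 0≤x = 0≤x
  ... | inj₂ x≤0 = ≤-respˡ-≈ (A.sym 0≈x+x) (≤-respʳ-≈ (A.identityˡ x) (+-mono-≤ x x≤0))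

  ≈∞-refl : ∀ x → x ≈∞ x
  ≈∞-refl (fin x) = A.refl
  ≈∞-refl ∞       = tt

  ≈∞-sym : ∀ x y → x ≈∞ y → y ≈∞ x
  ≈∞-sym (fin x) (fin y) x≈y = A.sym x≈y
  ≈∞-sym ∞       ∞       _   = tt

  ≈∞-trans : ∀ x y z → x ≈∞ y → y ≈∞ z → x ≈∞ z
  ≈∞-trans (fin x) (fin y) (fin z) x≈y y≈z = A.trans x≈y y≈z
  ≈∞-trans ∞       ∞       ∞       _   _   = tt

  ≈∞⇒≤∞ : ∀ x y → x ≈∞ y → x ≤∞ y
  ≈∞⇒≤∞ (fin x) (fin y) x≈y = O.reflexive x≈y
  ≈∞⇒≤∞ (fin x) ∞       _   = tt
  ≈∞⇒≤∞ ∞       ∞       _   = tt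

  ≈∞-setoid : Setoid c ℓ₁
  ≈∞-setoid = record
    { Carrier       = Γ∞
    ; _≈_           = _≈∞_
    ; isEquivalence = record
      { refl  = λ {x} → ≈∞-refl x
      ; sym   = λ {x} {y} → ≈∞-sym x y
      ; trans = λ {x} {y} {z} → ≈∞-trans x y z
      }
    }

  ∞-or-fin : ∀ x → x ≈∞ ∞ ⊎ ∃ λ g → x ≈∞ fin g
  ∞-or-fin ∞       = inj₁ tt
  ∞-or-fin (fin g) = inj₂ (g , A.refl)

  ≤∞-∞ : ∀ x → x ≤∞ ∞
  ≤∞-∞ (fin x) = tt
  ≤∞-∞ ∞       = tt

  ≤∞-trans : ∀ x y z → x ≤∞ y → y ≤∞ z → x ≤∞ z
  ≤∞-trans (fin x) (fin y) (fin z) x≤y y≤z = O.trans x≤y y≤z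
  ≤∞-trans (fin x) y       ∞       _   _   = tt
  ≤∞-trans ∞       y       ∞       _   _   = tt
  ≤∞-trans (fin x) ∞       (fin z) _   ()
  ≤∞-trans ∞       (fin y) (fin z) ()  _
  ≤∞-trans ∞       ∞       (fin z) _   ()

  ≤∞-resp-≈∞ : ∀ x x' y y' → x ≈∞ x' → y ≈∞ y' → x ≤∞ y → x' ≤∞ y'
  ≤∞-resp-≈∞ x x' y y' x≈x' y≈y' x≤y =
    ≤∞-trans x' x y' (≈∞⇒≤∞ x' x (≈∞-sym x x' x≈x')) (≤∞-trans x y y' x≤y (≈∞⇒≤∞ y y' y≈y'))

  <∞-≤∞-trans : ∀ x y z → x <∞ y → y ≤∞ z → x <∞ z
  <∞-≤∞-trans x y z (x≤y , y≰x) y≤z = ≤∞-trans x y z x≤y y≤z , λ z≤x → y≰x (≤∞-trans y z x y≤z z≤x)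

  ≰∞⇒>∞ : ∀ x y → ¬ (y ≤∞ fin x) → fin x <∞ y
  ≰∞⇒>∞ x ∞       _   = tt , λ ()
  ≰∞⇒>∞ x (fin y) y≰x with O.total x y
  ... | inj₁ x≤y = x≤y , y≰x
  ... | inj₂ y≤x = contradiction y≤x y≰x

  ≮∞⇒¬¬≈∞ : ∀ x y → fin x ≤∞ y → ¬ (fin x <∞ y) → ¬ ¬ (y ≈∞ fin x)
  ≮∞⇒¬¬≈∞ x ∞       _   x≮y _      = x≮y (tt , λ ())
  ≮∞⇒¬¬≈∞ x (fin y) x≤y x≮y y≉x = x≮y (x≤y , λ y≤x → y≉x (O.antisym y≤x x≤y))

  ≤∞-min : ∀ x y → ∃ λ z → z ≤∞ x × z ≤∞ y × (z ≡ x ⊎ z ≡ y)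
  ≤∞-min ∞       y       = y , ≤∞-∞ y , ≈∞⇒≤∞ y y (≈∞-refl y) , inj₂ refl
  ≤∞-min (fin x) ∞       = fin x , O.refl , tt , inj₁ refl
  ≤∞-min (fin x) (fin y) with O.total x y
  ... | inj₁ x≤y = fin x , O.refl , x≤y , inj₁ refl
  ... | inj₂ y≤x = fin y , y≤x , O.refl , inj₂ refl

  +∞-cong : ∀ x x' y y' → x ≈∞ x' → y ≈∞ y' → (x +∞ y) ≈∞ (x' +∞ y')
  +∞-cong (fin x) (fin x') (fin y) (fin y') x≈x' y≈y' = A.∙-cong x≈x' y≈y'
  +∞-cong (fin x) (fin x') ∞       ∞       _    _    = tt
  +∞-cong ∞       ∞        y       y'      _    _    = tt

  ·∞-cong-fin : ∀ k x g → x ≈∞ fin g → (k ·∞ x) ≈∞ fin (k · g)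
  ·∞-cong-fin zero    x g _   = A.refl
  ·∞-cong-fin (suc k) x g x≈g = +∞-cong x (fin g) (k ·∞ x) (fin (k · g)) x≈g (·∞-cong-fin k x g x≈g)

  ·∞-∞ : ∀ k x → x ≈∞ ∞ → (suc k ·∞ x) ≈∞ ∞
  ·∞-∞ k x x≈∞ = +∞-cong x ∞ (k ·∞ x) (k ·∞ x) x≈∞ (≈∞-refl (k ·∞ x))

  +∞-pos : ∀ x y → fin 0# ≤∞ x → fin 0# <∞ y → fin 0# <∞ (x +∞ y)
  +∞-pos ∞       y       _   _   = tt , λ ()
  +∞-pos (fin x) ∞       _   _   = tt , λ ()
  +∞-pos (fin x) (fin y) 0≤x 0<y = <∞-≤∞-trans (fin 0#) (fin y) (fin (x + y)) 0<y y≤x+y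
    where
    y≤x+y : y ≤ x + y
    y≤x+y = ≤-respˡ-≈ (A.identityˡ y) (+-mono-≤ y 0≤x)

module ValuationProperties {c ℓ c' ℓ₁ ℓ₂} {K : Field c ℓ} {Γ : LinOrdAbGroup c' ℓ₁ ℓ₂}
                           (V : Valuation K Γ) where
  open Field K hiding (refl)
  open Extended Γ
  open Valuation V
  open OrderedGroupProperties Γ
  private
    module G = LinOrdAbGroup Γ
    module A = AbelianGroup abelianGroup
    module ∞-Reasoning = SetoidReasoning ≈∞-setoid
    module +-Group = GroupProperties +-group
    module Mult = SemiringMult semiring
  open G using () renaming (_≤_ to infix 4 _≤_; _·_ to infixr 8 _·_)
  open RingProperties ring using (-1*x≈-x; -‿involutive)

  v-≈fin⇒≉0 : ∀ {x g} → v x ≈∞ fin g → ¬ x ≈ 0#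
  v-≈fin⇒≉0 {x} {g} vx≈g x≈0 = ⊥-elim (begin fin g ≈⟨ vx≈g ⟨ v x ≈⟨ v-cong x≈0 ⟩ v 0# ≈⟨ v-0 ⟩ ∞ ∎)
    where open ∞-Reasoning

  v-1+v-1≈v-1 : (v 1# +∞ v 1#) ≈∞ v 1#
  v-1+v-1≈v-1 = begin
    v 1# +∞ v 1#  ≈⟨ v-mul 1# 1# ⟨
    v (1# * 1#)   ≈⟨ v-cong (*-identityˡ 1#) ⟩
    v 1#          ∎
    where open ∞-Reasoning

  v-1≈0 : v 1# ≈∞ fin G.0#
  v-1≈0 with v 1# | v-∞⇒0 1# | v-1+v-1≈v-1
  ... | ∞     | v-1≈∞⇒1≈0 | _     = contradiction (v-1≈∞⇒1≈0 tt) 1≉0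
  ... | fin h | _         | h+h≈h = identityʳ-unique h h h+h≈h

  v-x+v-x⁻¹≈0 : ∀ {x g} → v x ≈∞ fin g → (fin g +∞ v (x ⁻¹)) ≈∞ fin G.0#
  v-x+v-x⁻¹≈0 {x} {g} vx≈g = begin
    fin g +∞ v (x ⁻¹)  ≈⟨ +∞-cong (v x) (fin g) (v (x ⁻¹)) (v (x ⁻¹)) vx≈g (≈∞-refl (v (x ⁻¹))) ⟨
    v x +∞ v (x ⁻¹)    ≈⟨ v-mul x (x ⁻¹) ⟨
    v (x * x ⁻¹)       ≈⟨ v-cong (inverseʳ x (v-≈fin⇒≉0 vx≈g)) ⟩
    v 1#               ≈⟨ v-1≈0 ⟩
    fin G.0#           ∎
    where open ∞-Reasoning

  v-⁻¹ : ∀ {x g} → v x ≈∞ fin g → v (x ⁻¹) ≈∞ fin (G.- g)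
  v-⁻¹ {x} {g} vx≈g with v (x ⁻¹) | v-x+v-x⁻¹≈0 vx≈g
  ... | ∞     | ()
  ... | fin h | g+h≈0 = inverseʳ-unique g h g+h≈0

  v-nonneg-1 : fin G.0# ≤∞ v 1#
  v-nonneg-1 = ≈∞⇒≤∞ (fin G.0#) (v 1#) (≈∞-sym (v 1#) (fin G.0#) v-1≈0)

  0≈v-‿1+v-‿1 : fin G.0# ≈∞ (v (- 1#) +∞ v (- 1#))
  0≈v-‿1+v-‿1 = begin
    fin G.0#               ≈⟨ v-1≈0 ⟨
    v 1#                   ≈⟨ v-cong (trans (-1*x≈-x (- 1#)) (-‿involutive 1#)) ⟨
    v (- 1# * - 1#)        ≈⟨ v-mul (- 1#) (- 1#) ⟩
    v (- 1#) +∞ v (- 1#)   ∎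
    where open ∞-Reasoning

  v-nonneg-‿1 : fin G.0# ≤∞ v (- 1#)
  v-nonneg-‿1 with v (- 1#) | 0≈v-‿1+v-‿1
  ... | ∞     | _     = tt
  ... | fin h | 0≈h+h = 0≈x+x⇒0≤x 0≈h+h

  v-nonneg-ℕ→K : ∀ m → fin G.0# ≤∞ v (ℕ→K m)
  v-nonneg-ℕ→K zero    = ≤∞-trans (fin G.0#) ∞ (v 0#) tt (≈∞⇒≤∞ ∞ (v 0#) (≈∞-sym (v 0#) ∞ v-0))
  v-nonneg-ℕ→K (suc m) = v-add 1# (ℕ→K m) (fin G.0#) v-nonneg-1 (v-nonneg-ℕ→K m)

  InM-cong : ∀ {x y} → x ≈ y → InM V x → InM V y
  InM-cong {x} {y} x≈y 0<vx = <∞-≤∞-trans (fin G.0#) (v x) (v y) 0<vx (≈∞⇒≤∞ (v x) (v y) (v-cong x≈y))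

  InM-+ : ∀ {x y} → InM V x → InM V y → InM V (x + y)
  InM-+ {x} {y} 0<vx 0<vy with ≤∞-min (v x) (v y)
  ... | z , z≤vx , z≤vy , z≡vx⊎vy =
    <∞-≤∞-trans (fin G.0#) z (v (x + y)) (0<z z≡vx⊎vy) (v-add x y z z≤vx z≤vy)
    where
    0<z : z ≡ v x ⊎ z ≡ v y → fin G.0# <∞ z
    0<z (inj₁ refl) = 0<vx
    0<z (inj₂ refl) = 0<vy

  InM-*ˡ : ∀ {c x} → fin G.0# ≤∞ v c → InM V x → InM V (c * x)
  InM-*ˡ {c} {x} 0≤vc 0<vx =
    <∞-≤∞-trans (fin G.0#) (v c +∞ v x) (v (c * x)) (+∞-pos (v c) (v x) 0≤vc 0<vx)
      (≈∞⇒≤∞ (v c +∞ v x) (v (c * x)) (≈∞-sym (v (c * x)) (v c +∞ v x) (v-mul c x)))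

  InM-‿ : ∀ {x} → InM V x → InM V (- x)
  InM-‿ {x} x∈M = InM-cong (-1*x≈-x x) (InM-*ˡ v-nonneg-‿1 x∈M)

  ℕ→K≡×1 : ∀ m → ℕ→K m ≡ m Mult.× 1#
  ℕ→K≡×1 zero    = refl
  ℕ→K≡×1 (suc m) = cong (1# +_) (ℕ→K≡×1 m)

  ℕ→K-+ : ∀ m n → ℕ→K (m ℕ.+ n) ≈ ℕ→K m + ℕ→K n
  ℕ→K-+ m n = begin
    ℕ→K (m ℕ.+ n)            ≡⟨ ℕ→K≡×1 (m ℕ.+ n) ⟩
    (m ℕ.+ n) Mult.× 1#      ≈⟨ Mult.×-homo-+ 1# m n ⟩
    m Mult.× 1# + n Mult.× 1# ≡⟨ cong₂ _+_ (ℕ→K≡×1 m) (ℕ→K≡×1 n) ⟨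
    ℕ→K m + ℕ→K n            ∎
    where open SetoidReasoning setoid

  ℕ→K-* : ∀ m n → ℕ→K (m ℕ.* n) ≈ ℕ→K m * ℕ→K n
  ℕ→K-* m n = begin
    ℕ→K (m ℕ.* n)              ≡⟨ ℕ→K≡×1 (m ℕ.* n) ⟩
    (m ℕ.* n) Mult.× 1#        ≈⟨ Mult.×1-homo-* m n ⟩
    m Mult.× 1# * n Mult.× 1#  ≡⟨ cong₂ _*_ (ℕ→K≡×1 m) (ℕ→K≡×1 n) ⟨
    ℕ→K m * ℕ→K n              ∎
    where open SetoidReasoning setoid

  InM-ℕ→K-% : ∀ n p .{{_ : ℕ.NonZero p}} → InM V (ℕ→K n) → InM V (ℕ→K p) → InM V (ℕ→K (n % p))
  InM-ℕ→K-% n p n∈M p∈M =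
    InM-cong (sym r≈n-qp) (InM-+ n∈M (InM-‿ (InM-*ˡ (v-nonneg-ℕ→K (n / p)) p∈M)))
    where
    n≈r+qp : ℕ→K n ≈ ℕ→K (n % p) + ℕ→K (n / p) * ℕ→K p
    n≈r+qp = begin
      ℕ→K n                                ≡⟨ cong ℕ→K (m≡m%n+[m/n]*n n p) ⟩
      ℕ→K (n % p ℕ.+ (n / p) ℕ.* p)        ≈⟨ ℕ→K-+ (n % p) ((n / p) ℕ.* p) ⟩
      ℕ→K (n % p) + ℕ→K ((n / p) ℕ.* p)    ≈⟨ +-congˡ (ℕ→K-* (n / p) p) ⟩
      ℕ→K (n % p) + ℕ→K (n / p) * ℕ→K p    ∎
      where open SetoidReasoning setoid
    r≈n-qp : ℕ→K (n % p) ≈ ℕ→K n - ℕ→K (n / p) * ℕ→K p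
    r≈n-qp = +-Group.x≈z//y (ℕ→K (n % p)) (ℕ→K (n / p) * ℕ→K p) (ℕ→K n) (sym n≈r+qp)

  minimal-InM-∣ : ∀ {n p} → InM V (ℕ→K n) → 0 < p → InM V (ℕ→K p) →
                  (∀ m → 0 < m → m < p → ¬ InM V (ℕ→K m)) → p ∣ n
  minimal-InM-∣ {n} {p@(suc _)} n∈M _ p∈M below with n % p ℕ.≟ 0
  ... | yes n%p≡0 = m%n≡0⇒n∣m n p n%p≡0
  ... | no  n%p≢0 = contradiction (InM-ℕ→K-% n p n∈M p∈M) (below (n % p) (ℕ.n≢0⇒n>0 n%p≢0) (m%n<n n p))

  ℕ→K-∉M : ∀ n → 0 < n → (∀ p → ResidueChar V p → ¬ (p ∣ n)) → ¬ InM V (ℕ→K n)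
  ℕ→K-∉M n 0<n char∤n n∈M = ¬¬-minimal PositiveInM n (0<n , n∈M) minimal-divides
    where
    PositiveInM : ℕ → Set ℓ₂
    PositiveInM m = 0 < m × InM V (ℕ→K m)
    minimal-divides : ¬ (∃ λ p → PositiveInM p × (∀ m → m < p → ¬ PositiveInM m))
    minimal-divides (p , (0<p , p∈M) , minimal) =
      char∤n p (inj₂ (0<p , p∈M , below)) (minimal-InM-∣ n∈M 0<p p∈M below)
      where
      below : ∀ m → 0 < m → m < p → ¬ InM V (ℕ→K m)
      below m 0<m m<p m∈M = minimal m m<p (0<m , m∈M)

  v-ℕ→K≈0 : ∀ n → 0 < n → (∀ p → ResidueChar V p → ¬ (p ∣ n)) → ¬ ¬ (v (ℕ→K n) ≈∞ fin G.0#)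
  v-ℕ→K≈0 n 0<n char∤n = ≮∞⇒¬¬≈∞ G.0# (v (ℕ→K n)) (v-nonneg-ℕ→K n) (ℕ→K-∉M n 0<n char∤n)

  v-*⁻¹ : ∀ {x y g} → v y ≈∞ fin g → v (x * y ⁻¹) ≈∞ (v x +∞ fin (G.- g))
  v-*⁻¹ {x} {y} {g} vy≈g = begin
    v (x * y ⁻¹)         ≈⟨ v-mul x (y ⁻¹) ⟩
    v x +∞ v (y ⁻¹)      ≈⟨ +∞-cong (v x) (v x) (v (y ⁻¹)) (fin (G.- g)) (≈∞-refl (v x)) (v-⁻¹ vy≈g) ⟩
    v x +∞ fin (G.- g)   ∎
    where open ∞-Reasoning

  module _ {S a} (ED : EisensteinDumas V (suc S) a) {g₀ gₙ}
           (v-a₀ : v (a 0) ≈∞ fin g₀) (v-aₙ : v (a (suc S)) ≈∞ fin gₙ) where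
    open EisensteinDumas ED

    D2-penultimate : ∀ {α} → v (a S) ≈∞ fin α → g₀ G.+ S · gₙ ≤ suc S · α
    D2-penultimate {α} v-aS≈α =
      ≤∞-resp-≈∞ lhs (fin (g₀ G.+ S · gₙ)) (suc S ·∞ v (a S)) (fin (suc S · α))
        lhs≈ (·∞-cong-fin (suc S) (v (a S)) α v-aS≈α) D2-at-S
      where
      lhs : Γ∞
      lhs = (1 ·∞ v (a 0)) +∞ (S ·∞ v (a (suc S)))
      D2-at-S : lhs ≤∞ (suc S ·∞ v (a S))
      D2-at-S = subst (λ k → ((k ·∞ v (a 0)) +∞ (S ·∞ v (a (suc S)))) ≤∞ (suc S ·∞ v (a S)))
                      (ℕ.m+n∸n≡m 1 S) (D2 S (ℕ.n≤1+n S))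
      lhs≈ : lhs ≈∞ fin (g₀ G.+ S · gₙ)
      lhs≈ = begin
        lhs                    ≈⟨ +∞-cong (1 ·∞ v (a 0)) (fin (1 · g₀)) (S ·∞ v (a (suc S))) (fin (S · gₙ))
                                            (·∞-cong-fin 1 (v (a 0)) g₀ v-a₀)
                                            (·∞-cong-fin S (v (a (suc S))) gₙ v-aₙ) ⟩
        fin (1 · g₀ G.+ S · gₙ) ≈⟨ A.∙-congʳ (A.identityʳ g₀) ⟩
        fin (g₀ G.+ S · gₙ)     ∎
        where open ∞-Reasoning

    v-n·aₙ≈gₙ : v (ℕ→K (suc S)) ≈∞ fin G.0# → v (ℕ→K (suc S) * a (suc S)) ≈∞ fin gₙ
    v-n·aₙ≈gₙ v-n≈0 = begin
      v (ℕ→K (suc S) * a (suc S))       ≈⟨ v-mul (ℕ→K (suc S)) (a (suc S)) ⟩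
      v (ℕ→K (suc S)) +∞ v (a (suc S))  ≈⟨ +∞-cong (v (ℕ→K (suc S))) (fin G.0#) (v (a (suc S))) (fin gₙ)
                                                  v-n≈0 v-aₙ ⟩
      fin (G.0# G.+ gₙ)                 ≈⟨ A.identityˡ gₙ ⟩
      fin gₙ                            ∎
      where open ∞-Reasoning

    v-ratio : Γ∞
    v-ratio = v (a S * (ℕ→K (suc S) * a (suc S)) ⁻¹)

    v-ratio≈v-aS-gₙ : v (ℕ→K (suc S)) ≈∞ fin G.0# → v-ratio ≈∞ (v (a S) +∞ fin (G.- gₙ))
    v-ratio≈v-aS-gₙ v-n≈0 = v-*⁻¹ (v-n·aₙ≈gₙ v-n≈0)

    coefficient-bound : 1 < suc S → v (ℕ→K (suc S)) ≈∞ fin G.0# →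
                        ¬ ((suc S ·∞ v-ratio) ≤∞ fin (g₀ G.- gₙ))
    coefficient-bound 1<n v-n≈0 bound with ∞-or-fin (v (a S))
    ... | inj₁ v-aS≈∞ =
      ⊥-elim (≤∞-resp-≈∞ (suc S ·∞ v-ratio) ∞ (fin (g₀ G.- gₙ)) (fin (g₀ G.- gₙ))
                (·∞-∞ S v-ratio v-ratio≈∞) A.refl bound)
      where
      v-ratio≈∞ : v-ratio ≈∞ ∞
      v-ratio≈∞ = ≈∞-trans v-ratio (v (a S) +∞ fin (G.- gₙ)) ∞ (v-ratio≈v-aS-gₙ v-n≈0)
                    (+∞-cong (v (a S)) ∞ (fin (G.- gₙ)) (fin (G.- gₙ)) v-aS≈∞ A.refl)
    ... | inj₂ (α , v-aS≈α) =
      D1 (suc S) 1<n ∣-refl g₀ gₙ v-a₀ v-aₙ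
         (α G.- gₙ , difference≈multiple S g₀ gₙ α (D2-penultimate v-aS≈α) upper)
      where
      v-ratio≈α-gₙ : v-ratio ≈∞ fin (α G.- gₙ)
      v-ratio≈α-gₙ = ≈∞-trans v-ratio (v (a S) +∞ fin (G.- gₙ)) (fin (α G.- gₙ)) (v-ratio≈v-aS-gₙ v-n≈0)
                       (+∞-cong (v (a S)) (fin α) (fin (G.- gₙ)) (fin (G.- gₙ)) v-aS≈α A.refl)
      upper : suc S · (α G.- gₙ) ≤ g₀ G.- gₙ
      upper = ≤∞-resp-≈∞ (suc S ·∞ v-ratio) (fin (suc S · (α G.- gₙ)))
                (fin (g₀ G.- gₙ)) (fin (g₀ G.- gₙ))
                (·∞-cong-fin (suc S) v-ratio (α G.- gₙ) v-ratio≈α-gₙ) A.refl bound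

open import Data.Nat using (_≤_)

lemma2p4 : ∀ {c ℓ c' ℓ₁ ℓ₂ : Level} (K : Field c ℓ) (Γ : LinOrdAbGroup c' ℓ₁ ℓ₂)
           (V : Valuation K Γ) (n : ℕ) → 2 ≤ n → (a : ℕ → Field.Carrier K) →
           ¬ (Field._≈_ K (a n) (Field.0# K)) →
           (∀ p → ResidueChar V p → ¬ (p ∣ n)) →
           EisensteinDumas V n a →
           ∀ g₀ gₙ →
           Extended._≈∞_ Γ (Valuation.v V (a 0)) (fin g₀) →
           Extended._≈∞_ Γ (Valuation.v V (a n)) (fin gₙ) →
           Extended._<∞_ Γ (fin (LinOrdAbGroup._-_ Γ g₀ gₙ))
             (Extended._·∞_ Γ n (Valuation.v V
               (Field._*_ K (a (n ∸ 1))
                 (Field._⁻¹ K (Field._*_ K (Field.ℕ→K K n) (a n))))))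
lemma2p4 K Γ V (suc S) 1<n a _ char∤n ED g₀ gₙ v-a₀ v-aₙ =
  ≰∞⇒>∞ (g₀ G.- gₙ) (suc S ·∞ v-ratio ED v-a₀ v-aₙ) λ bound →
    v-ℕ→K≈0 (suc S) (s≤s z≤n) char∤n λ v-n≈0 →
      coefficient-bound ED v-a₀ v-aₙ 1<n v-n≈0 bound
  where
  module G = LinOrdAbGroup Γ
  open Extended Γ
  open OrderedGroupProperties Γ
  open ValuationProperties V
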